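{- There is an algorithm that, given a universal axiomatic semantics $\mathcal{A}$ (a finite set of $\mu$spec axioms each of the form $\forall i_1\cdots\forall i_k\,\phi(i_1,\ldots,i_k)$ with $\phi$ quantifier-free, together with finite sets of cores, stages, operations $\mathbb{O}$ and the interpretations of the predicates over $\mathbb{O}$), determines whether $\mathcal{A}$ is refinable.
   Context: Programming model: cores $\mathsf{Cores}=[n]$; finite operation set $\mathbb{O}$; a program $\mathcal{P}$ is a family of instruction streams $\mathcal{I}_c\in\mathbb{O}^*$; an instruction is $(c,j,\mathcal{I}_c[j])$ with core $c$, label $j$ and operation $\mathcal{I}_c[j]$; events are $i.\mathsf{st}$ for instructions $i$ of $\mathcal{P}$ and stages $\mathsf{st}$ in a finite set $\mathsf{Stages}$. $\mu$spec syntax: quantifier-free formulas are boolean combinations ($\land,\lor,\neg$) of atoms $i_1<_r i_2$, $\mathsf{hb}(i_1.\mathsf{st}_1,i_2.\mathsf{st}_2)$, and $\mathsf{P}(i_1,\ldots)$ for predicates $\mathsf{P}$ whose interpretation is a given relation $\mathsf{P}^{\mathcal{A}}\subseteq\mathbb{O}^k$. A $\mu$hb graph for $\mathcal{P}$ is a DAG $G=(V,E)$ with $V$ the events of $\mathcal{P}$. Under an assignment $s$ of instructions to variables: $i_1<_r i_2$ holds iff $s(i_1),s(i_2)$ have the same core and the label of $s(i_1)$ is smaller; $\mathsf{P}(i_1,\ldots,i_m)$ holds iff the tuple of operations of $s(i_1),\ldots,s(i_m)$ lies in $\mathsf{P}^{\mathcal{A}}$; $\mathsf{hb}(i_1.\mathsf{st}_1,i_2.\mathsf{st}_2)$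 holds iff $(s(i_1).\mathsf{st}_1,s(i_2).\mathsf{st}_2)\in E^+$. Quantifiers range over instructions of $\mathcal{P}$ not already assigned to other variables (distinct assignments). $G\models_{\mathcal{P}}\mathcal{A}$ means $G$ satisfies every axiom. For $\mu$hb graphs $G=(V,E)$, $G'=(V',E')$, $G\sqsubseteq G'$ means $V=V'$ and $E^+\subseteq E'^+$. $\mathcal{A}$ is refinable if for every program $\mathcal{P}$ and every $G$ with $G\models_{\mathcal{P}}\mathcal{A}$, every linear (totally ordered) graph $G'$ with $G\sqsubseteq G'$ satisfies $G'\models_{\mathcal{P}}\mathcal{A}$. -}

module Defs where

open import Data.Nat using (ℕ; _<_)
open import Data.Fin using (Fin; toℕ)
open import Data.Bool using (Bool; T)
open import Data.List using (List; length; lookup)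
open import Data.List.Membership.Propositional using (_∈_)
open import Data.Vec using (Vec; map)
open import Data.Product using (Σ; _×_; _,_; proj₁; proj₂)
open import Data.Sum using (_⊎_)
open import Relation.Nullary using (¬_)
open import Relation.Binary.PropositionalEquality using (_≡_)
open import Relation.Binary.Construct.Closure.Transitive using (TransClosure)
open import Function.Definitions using (Injective)

data Formula (nSt nP : ℕ) (arity : Fin nP → ℕ) (k : ℕ) : Set where
  _<r_ : Fin k → Fin k → Formula nSt nP arity k
  hb   : Fin k → Fin nSt → Fin k → Fin nSt → Formula nSt nP arity k
  pred : (p : Fin nP) → Vec (Fin k) (arity p) → Formula nSt nP arity k
  _∧′_ : Formula nSt nP arity k → Formula nSt nP arity k → Formula nSt nP arity k
  _∨′_ : Formula nSt nP arity k → Formula nSt nP arity k → Formula nSt nP arity k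
  ¬′_  : Formula nSt nP arity k → Formula nSt nP arity k

record Semantics : Set where
  field
    nCores  : ℕ
    nStages : ℕ
    nOps    : ℕ
    nPreds  : ℕ
    arity   : Fin nPreds → ℕ
    interp  : (p : Fin nPreds) → Vec (Fin nOps) (arity p) → Bool
    axioms  : List (Σ ℕ (Formula nStages nPreds arity))

module _ (A : Semantics) where
  open Semantics A

  Program : Set
  Program = Fin nCores → List (Fin nOps)

  Instr : Program → Set
  Instr P = Σ (Fin nCores) (λ c → Fin (length (P c)))

  op : (P : Program) → Instr P → Fin nOps
  op P (c , j) = lookup (P c) j

  Event : Program → Set
  Event P = Instr P × Fin nStages

  Graph : Program → Set
  Graph P = Event P → Event P → Bool

  Edge : (P : Program) → Graph P → Event P → Event P → Set
  Edge P G u v = T (G u v)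

  Reach : (P : Program) → Graph P → Event P → Event P → Set
  Reach P G = TransClosure (Edge P G)

  IsDAG : (P : Program) → Graph P → Set
  IsDAG P G = ∀ v → ¬ Reach P G v v

  IsLinear : (P : Program) → Graph P → Set
  IsLinear P G = ∀ u v → ¬ (u ≡ v) → Reach P G u v ⊎ Reach P G v u

  -- G ⊑ G' : same vertex set by construction, E⁺ ⊆ E'⁺

  Sub : (P : Program) → Graph P → Graph P → Set
  Sub P G G' = ∀ u v → Reach P G u v → Reach P G' u v

  ⟦_⟧ : {k : ℕ} → Formula nStages nPreds arity k
        → (P : Program) → Graph P → (Fin k → Instr P) → Set
  ⟦_⟧ (x <r y) P G s =
    proj₁ (s x) ≡ proj₁ (s y) × toℕ (proj₂ (s x)) < toℕ (proj₂ (s y))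
  ⟦_⟧ (hb x st₁ y st₂) P G s = Reach P G (s x , st₁) (s y , st₂)
  ⟦_⟧ (pred p xs) P G s = T (interp p (map (λ x → op P (s x)) xs))
  ⟦ φ ∧′ ψ ⟧ P G s = ⟦ φ ⟧ P G s × ⟦ ψ ⟧ P G s
  ⟦ φ ∨′ ψ ⟧ P G s = ⟦ φ ⟧ P G s ⊎ ⟦ ψ ⟧ P G s
  ⟦ ¬′ φ ⟧ P G s = ¬ ⟦ φ ⟧ P G s

  -- ∀ i₁ … ∀ iₖ φ : quantifiers range over distinct instructions
  SatAxiom : (P : Program) → Graph P → Σ ℕ (Formula nStages nPreds arity) → Set
  SatAxiom P G (k , φ) =
    (s : Fin k → Instr P) → Injective _≡_ _≡_ s → ⟦ φ ⟧ P G s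

  Models : (P : Program) → Graph P → Set
  Models P G = ∀ ax → ax ∈ axioms → SatAxiom P G ax

Refinable : Semantics → Set
Refinable A =
  (P : Program A) (G : Graph A P) → IsDAG A P G → Models A P G →
  (G' : Graph A P) → IsDAG A P G' → IsLinear A P G' → Sub A P G G' →
  Models A P G'

-- A universal axiom ∀ i₁ … iₖ φ that fails in a graph fails at k distinct instructions. Restricting
-- the program to these instructions (a subsequence of each stream) and the graphs to the
-- reachability relation between them preserves program order, operations and reachability, hence
-- the truth of every quantifier-free formula. It therefore preserves being a model, a DAG, linear,
-- ⊑, and the failure. So A is refinable iff, for each axiom of arity k, the refinement condition
-- holds on the finitely many programs with at most k instructions per core, where graphs range
-- over finitely many adjacency relations and reachability is decided by Warshall's algorithm.

module Submission where

open import Defs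
open import Data.Bool using (Bool; true; false; T)
open import Data.Empty using (⊥-elim)
open import Data.Fin as Fin using (Fin; toℕ)
open import Data.Fin.Properties using (suc-injective; any?; injective⇒≤)
open import Data.List as List using (List; []; _∷_; length; concatMap; cartesianProductWith)
open import Data.List.Membership.Propositional using (_∈_; lose)
open import Data.List.Membership.Propositional.Properties
  using (∈-concatMap⁺; ∈-map⁺; ∈-allFin; ∈-cartesianProductWith⁺)
open import Data.List.Relation.Binary.Sublist.Propositional using (_⊆_; []; _∷_; _∷ʳ_)
open import Data.List.Relation.Unary.All as All using (All; all?)
open import Data.List.Relation.Unary.Any as Any using (here; there)
open import Data.List.Relation.Unary.Any.Properties using (lookup-index)
open import Data.Nat as ℕ using (ℕ; zero; suc; _≤_; z≤n; s≤s)
open import Data.Product using (Σ; _×_; _,_; proj₁; proj₂; ∃; map; map₂)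
open import Data.Product.Function.NonDependent.Propositional using (_×-⇔_)
open import Data.Product.Properties using (≡-dec; ,-injective; ,-injectiveˡ)
open import Data.Product.Properties.WithK using (,-injectiveʳ)
open import Data.Sum using (_⊎_; inj₁; inj₂; [_,_]′)
open import Data.Sum.Function.Propositional using (_⊎-⇔_)
open import Data.Vec as Vec using (Vec)
open import Data.Vec.Properties using (lookup∘tabulate; tabulate∘lookup; map-cong)
open import Function using (_∘_; _⇔_; mk⇔; Equivalence)
open import Function.Definitions using (Injective)
open import Function.Related.TypeIsomorphisms using (¬-cong-⇔)
open import Relation.Binary.Construct.Closure.Transitive using (TransClosure; [_]; _∷_; _++_)
import Relation.Binary.Definitions as B
open import Relation.Binary.PropositionalEquality
  using (_≡_; refl; sym; trans; cong; cong₂; subst; subst₂; _≗_)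
open import Relation.Nullary using (Dec; yes; no; ¬_; ¬?; _→-dec_)
open import Relation.Nullary.Decidable using (map′; _×-dec_; _⊎-dec_; ⌊_⌋; toWitness; fromWitness)
open import Relation.Nullary.Decidable.Core using (T?)
open import Relation.Unary using (Decidable)

record Finite (A : Set) : Set where
  field
    elements : List A
    complete : ∀ a → a ∈ elements

open Finite

∀? : {A : Set} {Q : A → Set} → Finite A → Decidable Q → Dec (∀ a → Q a)
∀? fin Q? = map′ (λ all a → All.lookup all (complete fin a)) (λ q → All.tabulate (λ {a} _ → q a))
                 (all? Q? (elements fin))

finite-Fin : (n : ℕ) → Finite (Fin n)
finite-Fin n = record { elements = List.allFin n ; complete = ∈-allFin }

finite-Bool : Finite Bool
finite-Bool = record
  { elements = true ∷ false ∷ []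
  ; complete = λ { true → here refl ; false → there (here refl) }
  }

finite-Σ : {A : Set} {B : A → Set} → Finite A → (∀ a → Finite (B a)) → Finite (Σ A B)
finite-Σ {A} {B} finA finB = record
  { elements = concatMap pairsWith (elements finA)
  ; complete = λ (a , b) →
      ∈-concatMap⁺ pairsWith (lose (complete finA a) (∈-map⁺ (a ,_) (complete (finB a) b)))
  }
  where
  pairsWith : (a : A) → List (Σ A B)
  pairsWith a = List.map (a ,_) (elements (finB a))

vectors : {A : Set} → List A → (n : ℕ) → List (Vec A n)
vectors xs zero    = Vec.[] ∷ []
vectors xs (suc n) = cartesianProductWith Vec._∷_ xs (vectors xs n)

tabulate∈vectors : {A : Set} {xs : List A} {n : ℕ} (f : Fin n → A) →
                   (∀ i → f i ∈ xs) → Vec.tabulate f ∈ vectors xs n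
tabulate∈vectors {n = zero}  f f∈ = here refl
tabulate∈vectors {n = suc n} f f∈ =
  ∈-cartesianProductWith⁺ Vec._∷_ (f∈ Fin.zero) (tabulate∈vectors (f ∘ Fin.suc) (f∈ ∘ Fin.suc))

finite-Vec : {A : Set} → Finite A → (n : ℕ) → Finite (Vec A n)
finite-Vec fin n = record
  { elements = vectors (elements fin) n
  ; complete = λ v → subst (_∈ _) (tabulate∘lookup v)
                       (tabulate∈vectors (Vec.lookup v) (complete fin ∘ Vec.lookup v))
  }

∀-Fin→? : {A : Set} {n : ℕ} {Q : (Fin n → A) → Set} → Finite A →
          (∀ {f g} → f ≗ g → Q f → Q g) → Decidable Q → Dec (∀ f → Q f)
∀-Fin→? {n = n} fin resp Q? =
  map′ (λ q f → resp (lookup∘tabulate f) (q (Vec.tabulate f))) (λ q v → q (Vec.lookup v))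
       (∀? (finite-Vec fin n) (Q? ∘ Vec.lookup))

lists≤ : {A : Set} → List A → ℕ → List (List A)
lists≤ xs zero    = [] ∷ []
lists≤ xs (suc k) = [] ∷ cartesianProductWith _∷_ xs (lists≤ xs k)

∈-lists≤ : {A : Set} (fin : Finite A) {k : ℕ} (l : List A) → length l ≤ k → l ∈ lists≤ (elements fin) k
∈-lists≤ fin {zero}  []      z≤n       = here refl
∈-lists≤ fin {suc k} []      _         = here refl
∈-lists≤ fin {suc k} (x ∷ l) (s≤s l≤k) =
  there (∈-cartesianProductWith⁺ _∷_ (complete fin x) (∈-lists≤ fin l l≤k))

-- Warshall's algorithm: allow the intermediate vertices of a path one at a time.
module Reachability {A : Set} (fin : Finite A) {R : A → A → Set} (R? : B.Decidable R) where

  infixr 5 _∷⟨_⟩_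

  data Via (ws : List A) : A → A → Set where
    edge   : ∀ {x y} → R x y → Via ws x y
    _∷⟨_⟩_ : ∀ {x w y} → R x w → w ∈ ws → Via ws w y → Via ws x y

  via-weaken : ∀ {z ws x y} → Via ws x y → Via (z ∷ ws) x y
  via-weaken (edge r)      = edge r
  via-weaken (r ∷⟨ w∈ ⟩ p) = r ∷⟨ there w∈ ⟩ via-weaken p

  via-join : ∀ {ws x z y} → Via ws x z → z ∈ ws → Via ws z y → Via ws x y
  via-join (edge r)      z∈ q = r ∷⟨ z∈ ⟩ q
  via-join (r ∷⟨ w∈ ⟩ p) z∈ q = r ∷⟨ w∈ ⟩ via-join p z∈ q

  via-split : ∀ {z ws x y} → Via (z ∷ ws) x y → Via ws x y ⊎ (Via ws x z × Via ws z y)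
  via-split (edge r) = inj₁ (edge r)
  via-split (r ∷⟨ here refl ⟩ p) with via-split p
  ... | inj₁ q       = inj₂ (edge r , q)
  ... | inj₂ (_ , q) = inj₂ (edge r , q)
  via-split (r ∷⟨ there w∈ ⟩ p) with via-split p
  ... | inj₁ q        = inj₁ (r ∷⟨ w∈ ⟩ q)
  ... | inj₂ (q , q′) = inj₂ (r ∷⟨ w∈ ⟩ q , q′)

  via? : ∀ ws → B.Decidable (Via ws)
  via? []       x y = map′ edge (λ { (edge r) → r ; (_ ∷⟨ () ⟩ _) }) (R? x y)
  via? (z ∷ ws) x y with via? ws x y | via? ws x z | via? ws z y
  ... | yes p | _     | _     = yes (via-weaken p)
  ... | no ¬p | yes q | yes q′ = yes (via-join (via-weaken q) (here refl) (via-weaken q′))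
  ... | no ¬p | no ¬q | _     = no λ v → [ ¬p , ¬q ∘ proj₁ ]′ (via-split v)
  ... | no ¬p | yes _ | no ¬q′ = no λ v → [ ¬p , ¬q′ ∘ proj₂ ]′ (via-split v)

  via⇒⁺ : ∀ {ws x y} → Via ws x y → TransClosure R x y
  via⇒⁺ (edge r)     = [ r ]
  via⇒⁺ (r ∷⟨ _ ⟩ p) = r ∷ via⇒⁺ p

  ⁺⇒via : ∀ {x y} → TransClosure R x y → Via (elements fin) x y
  ⁺⇒via [ r ]               = edge r
  ⁺⇒via (_∷_ {y = w} r r⁺) = r ∷⟨ complete fin w ⟩ ⁺⇒via r⁺

  ⁺? : B.Decidable (TransClosure R)
  ⁺? x y = map′ via⇒⁺ ⁺⇒via (via? (elements fin) x y)

module _ {X : Set} where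

  reindex : {xs ys : List X} → xs ⊆ ys → Fin (length xs) → Fin (length ys)
  reindex (y ∷ʳ τ) i             = Fin.suc (reindex τ i)
  reindex (_ ∷ τ)  Fin.zero      = Fin.zero
  reindex (_ ∷ τ)  (Fin.suc i)   = Fin.suc (reindex τ i)

  lookup-reindex : {xs ys : List X} (τ : xs ⊆ ys) (i : Fin (length xs)) →
                   List.lookup xs i ≡ List.lookup ys (reindex τ i)
  lookup-reindex (y ∷ʳ τ)   i           = lookup-reindex τ i
  lookup-reindex (refl ∷ τ) Fin.zero    = refl
  lookup-reindex (refl ∷ τ) (Fin.suc i) = lookup-reindex τ i

  reindex-injective : {xs ys : List X} (τ : xs ⊆ ys) {i j : Fin (length xs)} →
                      reindex τ i ≡ reindex τ j → i ≡ j
  reindex-injective (y ∷ʳ τ) eq = reindex-injective τ (suc-injective eq)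
  reindex-injective (_ ∷ τ) {Fin.zero}  {Fin.zero}  eq = refl
  reindex-injective (_ ∷ τ) {Fin.suc i} {Fin.suc j} eq = cong Fin.suc (reindex-injective τ (suc-injective eq))

  reindex-mono-< : {xs ys : List X} (τ : xs ⊆ ys) {i j : Fin (length xs)} →
                   i Fin.< j → reindex τ i Fin.< reindex τ j
  reindex-mono-< (y ∷ʳ τ) i<j = s≤s (reindex-mono-< τ i<j)
  reindex-mono-< (_ ∷ τ) {Fin.zero}  {Fin.suc j} i<j       = s≤s z≤n
  reindex-mono-< (_ ∷ τ) {Fin.suc i} {Fin.suc j} (s≤s i<j) = s≤s (reindex-mono-< τ i<j)

  reindex-cancel-< : {xs ys : List X} (τ : xs ⊆ ys) {i j : Fin (length xs)} →
                     reindex τ i Fin.< reindex τ j → i Fin.< j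
  reindex-cancel-< (y ∷ʳ τ) (s≤s lt) = reindex-cancel-< τ lt
  reindex-cancel-< (_ ∷ τ) {Fin.zero}  {Fin.suc j} lt       = s≤s z≤n
  reindex-cancel-< (_ ∷ τ) {Fin.suc i} {Fin.suc j} (s≤s lt) = s≤s (reindex-cancel-< τ lt)

  record Selection (xs : List X) (K : Fin (length xs) → Set) (ys : List X) : Set where
    field
      sublist  : ys ⊆ xs
      kept     : ∀ i → K (reindex sublist i)
      covering : ∀ j → K j → ∃ λ i → reindex sublist i ≡ j

  selection-[] : {K : Fin 0 → Set} → Selection [] K []
  selection-[] = record { sublist = [] ; kept = λ () ; covering = λ () }

  selection-keep : ∀ {x xs ys K} → K Fin.zero → Selection xs (K ∘ Fin.suc) ys →
                   Selection (x ∷ xs) K (x ∷ ys)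
  selection-keep k₀ sel = record
    { sublist  = refl ∷ sublist
    ; kept     = λ { Fin.zero → k₀ ; (Fin.suc i) → kept i }
    ; covering = λ { Fin.zero    _ → Fin.zero , refl
                   ; (Fin.suc j) k → map Fin.suc (cong Fin.suc) (covering j k) }
    }
    where open Selection sel

  selection-skip : ∀ {x xs ys K} → ¬ K Fin.zero → Selection xs (K ∘ Fin.suc) ys → Selection (x ∷ xs) K ys
  selection-skip {x} ¬k₀ sel = record
    { sublist  = x ∷ʳ sublist
    ; kept     = kept
    ; covering = λ { Fin.zero k → ⊥-elim (¬k₀ k) ; (Fin.suc j) k → map₂ (cong Fin.suc) (covering j k) }
    }
    where open Selection sel

  select : (xs : List X) {K : Fin (length xs) → Set} → Decidable K → List X
  select []       K? = []
  select (x ∷ xs) K? with K? Fin.zero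
  ... | yes _ = x ∷ select xs (K? ∘ Fin.suc)
  ... | no _  = select xs (K? ∘ Fin.suc)

  select-selection : (xs : List X) {K : Fin (length xs) → Set} (K? : Decidable K) →
                     Selection xs K (select xs K?)
  select-selection []       K? = selection-[]
  select-selection (x ∷ xs) K? with K? Fin.zero
  ... | yes k₀ = selection-keep k₀ (select-selection xs (K? ∘ Fin.suc))
  ... | no ¬k₀ = selection-skip ¬k₀ (select-selection xs (K? ∘ Fin.suc))

module _ (A : Semantics) where
  open Semantics A

  Axiom : Set
  Axiom = Σ ℕ (Formula nStages nPreds arity)

  finite-Instr : (P : Program A) → Finite (Instr A P)
  finite-Instr P = finite-Σ (finite-Fin nCores) (finite-Fin ∘ length ∘ P)

  finite-Event : (P : Program A) → Finite (Event A P)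
  finite-Event P = finite-Σ (finite-Instr P) (λ _ → finite-Fin nStages)

  _≟ᵢ_ : {P : Program A} → B.DecidableEquality (Instr A P)
  _≟ᵢ_ = ≡-dec Fin._≟_ Fin._≟_

  _≟ₑ_ : {P : Program A} → B.DecidableEquality (Event A P)
  _≟ₑ_ {P} = ≡-dec (_≟ᵢ_ {P}) Fin._≟_

  reach? : (P : Program A) (G : Graph A P) → B.Decidable (Reach A P G)
  reach? P G = Reachability.⁺? (finite-Event P) (λ u v → T? (G u v))

  _≺_ : {P : Program A} → Instr A P → Instr A P → Set
  u ≺ v = proj₁ u ≡ proj₁ v × toℕ (proj₂ u) ℕ.< toℕ (proj₂ v)

  ⟦_⟧? : ∀ {k} (φ : Formula nStages nPreds arity k) (P : Program A) (G : Graph A P) →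
         Decidable (⟦_⟧ A φ P G)
  ⟦ x <r y ⟧? P G s        = (proj₁ (s x) Fin.≟ proj₁ (s y)) ×-dec (toℕ (proj₂ (s x)) ℕ.<? toℕ (proj₂ (s y)))
  ⟦ hb x st y st′ ⟧? P G s = reach? P G (s x , st) (s y , st′)
  ⟦ pred p xs ⟧? P G s     = T? _
  ⟦ φ ∧′ ψ ⟧? P G s        = ⟦ φ ⟧? P G s ×-dec ⟦ ψ ⟧? P G s
  ⟦ φ ∨′ ψ ⟧? P G s        = ⟦ φ ⟧? P G s ⊎-dec ⟦ ψ ⟧? P G s
  ⟦ ¬′ φ ⟧? P G s          = ¬? (⟦ φ ⟧? P G s)

  ⟦⟧-resp-≗ : ∀ {k} (φ : Formula nStages nPreds arity k) {P : Program A} {G : Graph A P}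
              {s s′ : Fin k → Instr A P} → s ≗ s′ → ⟦_⟧ A φ P G s → ⟦_⟧ A φ P G s′
  ⟦⟧-resp-≗ (x <r y) {P} s≗s′ = subst₂ (_≺_ {P}) (s≗s′ x) (s≗s′ y)
  ⟦⟧-resp-≗ (hb x st y st′) {P} {G} s≗s′ =
    subst₂ (λ u v → Reach A P G (u , st) (v , st′)) (s≗s′ x) (s≗s′ y)
  ⟦⟧-resp-≗ (pred p xs) {P} s≗s′ = subst (T ∘ interp p) (map-cong (cong (op A P) ∘ s≗s′) xs)
  ⟦⟧-resp-≗ (φ ∧′ ψ) s≗s′ (h , h′) = ⟦⟧-resp-≗ φ s≗s′ h , ⟦⟧-resp-≗ ψ s≗s′ h′
  ⟦⟧-resp-≗ (φ ∨′ ψ) s≗s′ (inj₁ h) = inj₁ (⟦⟧-resp-≗ φ s≗s′ h)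
  ⟦⟧-resp-≗ (φ ∨′ ψ) s≗s′ (inj₂ h) = inj₂ (⟦⟧-resp-≗ ψ s≗s′ h)
  ⟦⟧-resp-≗ (¬′ φ) s≗s′ ¬h = ¬h ∘ ⟦⟧-resp-≗ φ (sym ∘ s≗s′)

  injective? : ∀ {k} {P : Program A} (s : Fin k → Instr A P) → Dec (Injective _≡_ _≡_ s)
  injective? {k} {P} s = map′ (λ inj {x} {y} → inj x y) (λ inj x y → inj)
    (∀? (finite-Fin k) λ x → ∀? (finite-Fin k) λ y → (_≟ᵢ_ {P} (s x) (s y)) →-dec (x Fin.≟ y))

  satAxiom? : (P : Program A) (G : Graph A P) → Decidable (SatAxiom A P G)
  satAxiom? P G (k , φ) = ∀-Fin→? (finite-Instr P) resp (λ s → injective? {P = P} s →-dec ⟦ φ ⟧? P G s)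
    where
    resp : ∀ {s s′} → s ≗ s′ → (Injective _≡_ _≡_ s → ⟦_⟧ A φ P G s) →
           Injective _≡_ _≡_ s′ → ⟦_⟧ A φ P G s′
    resp s≗s′ sat inj′ =
      ⟦⟧-resp-≗ φ s≗s′ (sat λ {x} {y} eq → inj′ (trans (sym (s≗s′ x)) (trans eq (s≗s′ y))))

  models? : (P : Program A) (G : Graph A P) → Dec (Models A P G)
  models? P G = map′ (λ all ax ax∈ → All.lookup all ax∈) (λ m → All.tabulate (m _))
                     (all? (satAxiom? P G) axioms)

  isDAG? : (P : Program A) (G : Graph A P) → Dec (IsDAG A P G)
  isDAG? P G = ∀? (finite-Event P) λ v → ¬? (reach? P G v v)

  isLinear? : (P : Program A) (G : Graph A P) → Dec (IsLinear A P G)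
  isLinear? P G = ∀? (finite-Event P) λ u → ∀? (finite-Event P) λ v →
    ¬? (_≟ₑ_ {P} u v) →-dec (reach? P G u v ⊎-dec reach? P G v u)

  sub? : (P : Program A) (G G′ : Graph A P) → Dec (Sub A P G G′)
  sub? P G G′ = ∀? (finite-Event P) λ u → ∀? (finite-Event P) λ v →
    reach? P G u v →-dec reach? P G′ u v

  Refines : (P : Program A) → Graph A P → Graph A P → Axiom → Set
  Refines P G G′ ax =
    IsDAG A P G → Models A P G → IsDAG A P G′ → IsLinear A P G′ → Sub A P G G′ → SatAxiom A P G′ ax

  refines? : (P : Program A) (G G′ : Graph A P) → Decidable (Refines P G G′)
  refines? P G G′ ax =
    isDAG? P G →-dec models? P G →-dec isDAG? P G′ →-dec isLinear? P G′ →-dec sub? P G G′ →-dec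
    satAxiom? P G′ ax

  -- Without function extensionality, quantifying over graphs is only finite when they are
  -- given by adjacency bits.
  module _ (P : Program A) where

    finite-EventPair : Finite (Event A P × Event A P)
    finite-EventPair = finite-Σ (finite-Event P) (λ _ → finite-Event P)

    Adjacency : Set
    Adjacency = Vec Bool (length (elements finite-EventPair))

    graph : Adjacency → Graph A P
    graph w u v = Vec.lookup w (Any.index (complete finite-EventPair (u , v)))

    adjacency : (Event A P × Event A P → Bool) → Adjacency
    adjacency f = Vec.tabulate (f ∘ List.lookup (elements finite-EventPair))

    graph-adjacency : ∀ f u v → graph (adjacency f) u v ≡ f (u , v)
    graph-adjacency f u v =
      trans (lookup∘tabulate (f ∘ List.lookup (elements finite-EventPair)) (Any.index uv∈))
            (cong f (sym (lookup-index uv∈)))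
      where uv∈ = complete finite-EventPair (u , v)

    RefinableOn : Axiom → Set
    RefinableOn ax = ∀ w w′ → Refines P (graph w) (graph w′) ax

    refinableOn? : Decidable RefinableOn
    refinableOn? ax = ∀? (finite-Vec finite-Bool _) λ w → ∀? (finite-Vec finite-Bool _) λ w′ →
      refines? P (graph w) (graph w′) ax

  -- Programs with at most k operations per core, as vectors so that they can be listed.
  smallPrograms : ℕ → List (Vec (List (Fin nOps)) nCores)
  smallPrograms k = vectors (lists≤ (elements (finite-Fin nOps)) k) nCores

  RefinableOnSmallPrograms : Set
  RefinableOnSmallPrograms =
    All (λ ax → All (λ v → RefinableOn (Vec.lookup v) ax) (smallPrograms (proj₁ ax))) axioms

  refinableOnSmallPrograms? : Dec RefinableOnSmallPrograms
  refinableOnSmallPrograms? = all? (λ ax → all? (λ v → refinableOn? (Vec.lookup v) ax) _) axioms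

  refinable⇒refinableOnSmallPrograms : Refinable A → RefinableOnSmallPrograms
  refinable⇒refinableOnSmallPrograms refinable =
    All.tabulate λ ax∈ → All.tabulate λ {v} _ w w′ dag models dag′ linear sub →
      refinable (Vec.lookup v) (graph (Vec.lookup v) w) dag models (graph (Vec.lookup v) w′)
                dag′ linear sub _ ax∈

  Subprogram : Program A → Program A → Set
  Subprogram P₀ P = ∀ c → P₀ c ⊆ P c

  module Pullback {P₀ P : Program A} (τ : Subprogram P₀ P) where

    instr : Instr A P₀ → Instr A P
    instr u = proj₁ u , reindex (τ (proj₁ u)) (proj₂ u)

    event : Event A P₀ → Event A P
    event (u , st) = instr u , st

    instr-injective : Injective _≡_ _≡_ instr
    instr-injective {c , i} {c′ , j} eq with ,-injectiveˡ eq
    ... | refl = cong (c ,_) (reindex-injective (τ c) (,-injectiveʳ eq))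

    event-injective : Injective _≡_ _≡_ event
    event-injective {u , st} {v , st′} eq =
      cong₂ _,_ (instr-injective (proj₁ (,-injective eq))) (proj₂ (,-injective eq))

    ≺-pullback : (u v : Instr A P₀) → _≺_ {P₀} u v ⇔ _≺_ {P} (instr u) (instr v)
    ≺-pullback (c , i) (c′ , j) = mk⇔ (λ { (refl , i<j) → refl , reindex-mono-< (τ c) i<j })
                                      (λ { (refl , i<j) → refl , reindex-cancel-< (τ c) i<j })

    op-pullback : (u : Instr A P₀) → op A P₀ u ≡ op A P (instr u)
    op-pullback (c , i) = lookup-reindex (τ c) i

    Induced : Graph A P₀ → Graph A P → Set
    Induced G₀ G = ∀ x y → Edge A P₀ G₀ x y ⇔ Reach A P G (event x) (event y)

    module _ {G₀ : Graph A P₀} {G : Graph A P} (induced : Induced G₀ G) where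

      reach-pullback : ∀ x y → Reach A P₀ G₀ x y ⇔ Reach A P G (event x) (event y)
      reach-pullback x y = mk⇔ to′ (λ r → [ Equivalence.from (induced x y) r ])
        where
        to′ : ∀ {x y} → Reach A P₀ G₀ x y → Reach A P G (event x) (event y)
        to′ [ e ]     = Equivalence.to (induced _ _) e
        to′ (e ∷ e⁺) = Equivalence.to (induced _ _) e ++ to′ e⁺

      ⟦⟧-pullback : ∀ {k} (φ : Formula nStages nPreds arity k) (s : Fin k → Instr A P₀) →
                    ⟦_⟧ A φ P₀ G₀ s ⇔ ⟦_⟧ A φ P G (instr ∘ s)
      ⟦⟧-pullback (x <r y)        s = ≺-pullback (s x) (s y)
      ⟦⟧-pullback (hb x st y st′) s = reach-pullback (s x , st) (s y , st′)
      ⟦⟧-pullback (pred p xs)     s = mk⇔ (subst (T ∘ interp p) ops≡) (subst (T ∘ interp p) (sym ops≡))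
        where ops≡ = map-cong (op-pullback ∘ s) xs
      ⟦⟧-pullback (φ ∧′ ψ) s = ⟦⟧-pullback φ s ×-⇔ ⟦⟧-pullback ψ s
      ⟦⟧-pullback (φ ∨′ ψ) s = ⟦⟧-pullback φ s ⊎-⇔ ⟦⟧-pullback ψ s
      ⟦⟧-pullback (¬′ φ)   s = ¬-cong-⇔ (⟦⟧-pullback φ s)

      isDAG-pullback : IsDAG A P G → IsDAG A P₀ G₀
      isDAG-pullback dag x = dag (event x) ∘ Equivalence.to (reach-pullback x x)

      models-pullback : Models A P G → Models A P₀ G₀
      models-pullback models (k , φ) ax∈ s inj =
        Equivalence.from (⟦⟧-pullback φ s) (models (k , φ) ax∈ (instr ∘ s) (inj ∘ instr-injective))

      isLinear-pullback : IsLinear A P G → IsLinear A P₀ G₀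
      isLinear-pullback linear x y x≢y with linear (event x) (event y) (x≢y ∘ event-injective)
      ... | inj₁ r = inj₁ (Equivalence.from (reach-pullback x y) r)
      ... | inj₂ r = inj₂ (Equivalence.from (reach-pullback y x) r)

    sub-pullback : ∀ {G₀ G G₀′ G′} → Induced G₀ G → Induced G₀′ G′ → Sub A P G G′ → Sub A P₀ G₀ G₀′
    sub-pullback induced induced′ sub x y =
      Equivalence.from (reach-pullback induced′ x y) ∘ sub _ _ ∘ Equivalence.to (reach-pullback induced x y)

    embeddedReach : Graph A P → Event A P₀ × Event A P₀ → Bool
    embeddedReach G (x , y) = ⌊ reach? P G (event x) (event y) ⌋

    induced : Graph A P → Adjacency P₀
    induced G = adjacency P₀ (embeddedReach G)

    graph-induced : ∀ G → Induced (graph P₀ (induced G)) G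
    graph-induced G x y = mk⇔ (toWitness ∘ subst T edge≡) (subst T (sym edge≡) ∘ fromWitness)
      where edge≡ = graph-adjacency P₀ (embeddedReach G) x y

  module Restriction (P : Program A) {k : ℕ} (s : Fin k → Instr A P)
                     (s-injective : Injective _≡_ _≡_ s) where

    Hit : (c : Fin nCores) → Fin (length (P c)) → Set
    Hit c j = ∃ λ i → s i ≡ (c , j)

    hit? : ∀ c → Decidable (Hit c)
    hit? c j = any? λ i → _≟ᵢ_ {P} (s i) (c , j)

    restriction : Vec (List (Fin nOps)) nCores
    restriction = Vec.tabulate λ c → select (P c) (hit? c)

    P₀ : Program A
    P₀ = Vec.lookup restriction

    selection : ∀ c → Selection (P c) (Hit c) (P₀ c)
    selection c =
      subst (Selection (P c) (Hit c)) (sym (lookup∘tabulate _ c)) (select-selection (P c) (hit? c))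

    τ : Subprogram P₀ P
    τ c = Selection.sublist (selection c)

    open Pullback τ

    covering : ∀ i → ∃ λ j → reindex (τ (proj₁ (s i))) j ≡ proj₂ (s i)
    covering i = Selection.covering (selection (proj₁ (s i))) (proj₂ (s i)) (i , refl)

    s₀ : Fin k → Instr A P₀
    s₀ i = proj₁ (s i) , proj₁ (covering i)

    instr∘s₀ : instr ∘ s₀ ≗ s
    instr∘s₀ i = cong (proj₁ (s i) ,_) (proj₂ (covering i))

    s₀-injective : Injective _≡_ _≡_ s₀
    s₀-injective {i} {j} eq = s-injective (trans (sym (instr∘s₀ i)) (trans (cong instr eq) (instr∘s₀ j)))

    -- Each kept instruction is hit by a distinct i : Fin k.
    length-select≤ : ∀ c → length (select (P c) (hit? c)) ≤ k
    length-select≤ c = injective⇒≤ hitter-injective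
      where
      open Selection (select-selection (P c) (hit? c))
      hitter-injective : Injective _≡_ _≡_ (proj₁ ∘ kept)
      hitter-injective {i} {j} eq = reindex-injective sublist
        (,-injectiveʳ (trans (sym (proj₂ (kept i))) (trans (cong s eq) (proj₂ (kept j)))))

    restriction-small : restriction ∈ smallPrograms k
    restriction-small = tabulate∈vectors _ λ c → ∈-lists≤ (finite-Fin nOps) _ (length-select≤ c)

  refinableOnSmallPrograms⇒refinable : RefinableOnSmallPrograms → Refinable A
  refinableOnSmallPrograms⇒refinable small P G dag models G′ dag′ linear sub (k , φ) ax∈ s s-injective =
    ⟦⟧-resp-≗ φ instr∘s₀ (Equivalence.to (⟦⟧-pullback induced′ φ s₀) sat₀)
    where
    open Restriction P s s-injective
    open Pullback τ
    induced₀ : Induced (graph P₀ (induced G)) G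
    induced₀ = graph-induced G
    induced′ : Induced (graph P₀ (induced G′)) G′
    induced′ = graph-induced G′
    sat₀ : ⟦_⟧ A φ P₀ (graph P₀ (induced G′)) s₀
    sat₀ = All.lookup (All.lookup small ax∈) restriction-small (induced G) (induced G′)
             (isDAG-pullback induced₀ dag) (models-pullback induced₀ models) (isDAG-pullback induced′ dag′)
             (isLinear-pullback induced′ linear) (sub-pullback induced₀ induced′ sub) s₀ s₀-injective

lemma1 : (A : Semantics) → Dec (Refinable A)
lemma1 A = map′ (refinableOnSmallPrograms⇒refinable A) (refinable⇒refinableOnSmallPrograms A)
                (refinableOnSmallPrograms? A)
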